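{- If $G$ is a tree with at least two vertices, then $$q(G)=\max_{uv\in E(G)}\min\left\{\frac{d(u)}{d[u]},\ \frac{d(v)}{d[v]}\right\}.$$
   Context: All graphs are finite, simple and undirected. For a vertex $v$, $d(v)$ is its degree, $N[v]$ its closed neighbourhood and $d[v]=d(v)+1$. A partition of $G$ is a pair $(V_1,V_2)$ of nonempty disjoint sets with union $V(G)$; for $v\in V_i$, $q^i(v)=|N[v]\cap V_i|/d[v]$, and $q(G)=\max_{(V_1,V_2)}\min\{q^i(v): i\in\{1,2\}, v\in V_i\}$ over all partitions. -}

module Defs where

open import Data.Bool using (Bool; true; false; if_then_else_)
open import Data.Nat using (ℕ; suc; _≤_)
open import Data.Fin using (Fin)
open import Data.List using (List; []; _∷_; _++_; [_]; length; map; allFin)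
open import Data.Nat.ListAction using (sum)
open import Data.List.Relation.Unary.Linked using (Linked)
open import Data.List.Relation.Unary.Unique.Propositional using (Unique)
open import Data.Integer using (+_)
open import Data.Rational using (ℚ; _/_; _⊓_) renaming (_≤_ to _≤ℚ_)
open import Data.Product using (Σ; ∃; _×_)
open import Relation.Binary.PropositionalEquality using (_≡_)
open import Relation.Nullary using (¬_)

record Graph (n : ℕ) : Set where
  field
    adj    : Fin n → Fin n → Bool
    sym    : ∀ u v → adj u v ≡ adj v u
    irrefl : ∀ v → adj v v ≡ false

module _ {n : ℕ} (G : Graph n) where
  open Graph G

  Adj : Fin n → Fin n → Set
  Adj u v = adj u v ≡ true

  data Walk : Fin n → Fin n → Set where
    stop : ∀ {u} → Walk u u
    step : ∀ {u v w} → Adj u v → Walk v w → Walk u w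

  Connected : Set
  Connected = ∀ u v → Walk u v

  HasCycle : Set
  HasCycle = Σ (Fin n) λ x → Σ (List (Fin n)) λ ys →
    Unique (x ∷ ys) × 2 ≤ length ys × Linked Adj (x ∷ ys ++ [ x ])

  IsTree : Set
  IsTree = Connected × ¬ HasCycle

  degree : Fin n → ℕ
  degree v = sum (map (λ u → if adj v u then 1 else 0) (allFin n))

  degRatio : Fin n → ℚ
  degRatio v = (+ degree v) / suc (degree v)

  -- A partition (V₁,V₂) is encoded by side : Fin n → Bool (V₁ = true-side),
  -- with both sides nonempty.
  IsPartition : (Fin n → Bool) → Set
  IsPartition side = (∃ λ v → side v ≡ true) × (∃ λ v → side v ≡ false)

  sameSide : Bool → Bool → ℕ
  sameSide true  true  = 1
  sameSide false false = 1
  sameSide _     _     = 0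

  closedSame : (Fin n → Bool) → Fin n → ℕ
  closedSame side v =
    suc (sum (map (λ u → if adj v u then sameSide (side u) (side v) else 0) (allFin n)))

  qv : (Fin n → Bool) → Fin n → ℚ
  qv side v = (+ closedSame side v) / suc (degree v)

  IsMinQ : (Fin n → Bool) → ℚ → Set
  IsMinQ side r = (∃ λ v → qv side v ≡ r) × (∀ v → r ≤ℚ qv side v)

  IsQ : ℚ → Set
  IsQ r = (Σ (Fin n → Bool) λ side → IsPartition side × IsMinQ side r)
        × (∀ side s → IsPartition side → IsMinQ side s → s ≤ℚ r)

  IsEdgeMax : ℚ → Set
  IsEdgeMax r = (∃ λ u → ∃ λ v → Adj u v × degRatio u ⊓ degRatio v ≡ r)
              × (∀ u v → Adj u v → degRatio u ⊓ degRatio v ≤ℚ r)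

-- Some edge xy of a connected graph crosses any partition, and each endpoint then loses a
-- neighbour: q(x) ≤ d(x)/d[x] and q(y) ≤ d(y)/d[y]; so q(G) is at most the edge maximum.
-- Conversely, put the component of u in T − uv on one side, for a maximising edge uv.
-- As T has no cycle, uv is the only crossing edge, so q(u) = d(u)/d[u], q(v) = d(v)/d[v]
-- and every other vertex has q(w) = 1.
module Submission where

open import Defs
open import Data.Bool using (Bool; true; false; if_then_else_) renaming (_≟_ to _≟ᵇ_)
open import Data.Bool.Properties using (⇔→≡)
open import Data.Empty using (⊥-elim)
open import Data.Fin using (Fin; zero; suc; _≟_)
open import Data.Fin.Properties using (any?; injective⇒≤)
open import Data.Integer using (+_; +≤+) renaming (_≤_ to _≤ℤ_)
import Data.Integer.Properties as ℤ
open import Data.List using (List; []; _∷_; _++_; [_]; length; map; filter; allFin; lookup; cartesianProduct)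
open import Data.List.Properties using (map-cong; map-cong-local)
open import Data.List.Membership.Propositional using (_∈_)
open import Data.List.Membership.Propositional.Properties using (∈-allFin; ∈-lookup; ∈-cartesianProduct⁺; ∈-filter⁺)
import Data.List.Membership.DecPropositional as DecMembership
open import Data.List.Relation.Unary.All as All using (All; []; _∷_)
open import Data.List.Relation.Unary.All.Properties using (all-filter; ¬Any⇒All¬)
open import Data.List.Relation.Unary.Any using (here; there)
open import Data.List.Relation.Unary.AllPairs using ([]; _∷_)
open import Data.List.Relation.Unary.Linked using (Linked; [-]; _∷_)
open import Data.List.Relation.Unary.Unique.Propositional using (Unique)
open import Data.List.Relation.Unary.Unique.Propositional.Properties using (allFin⁺)
open import Data.Nat using (ℕ; zero; suc; _≤_; _<_; _+_; _*_; z≤n; s≤s)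
import Data.Nat.Properties as ℕ
open import Data.Nat.ListAction using (sum)
open import Data.Product using (∃; ∃₂; _×_; _,_; proj₁; proj₂; uncurry)
open import Data.Rational using (ℚ; _/_; _⊓_) renaming (_≤_ to _≤ℚ_)
import Data.Rational.Properties as ℚ
open import Data.Rational.Unnormalised using (mkℚᵘ; *≤*)
import Data.Rational.Unnormalised.Properties as ℚᵘ
open import Data.Sum using (_⊎_; inj₁; inj₂)
open import Function using (_∘_)
open import Function.Bundles using (mk⇔)
open import Relation.Binary.Bundles using (DecTotalOrder)
open import Relation.Binary.PropositionalEquality
  using (_≡_; _≢_; refl; sym; trans; cong; cong₂; subst; subst₂; module ≡-Reasoning)
open import Relation.Nullary using (¬_; Dec; yes; no; does)
open import Relation.Nullary.Decidable using (dec-true; _×-dec_; _⊎-dec_; ¬?)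

open import Data.List.Extrema (DecTotalOrder.totalOrder ℚ.≤-decTotalOrder)
  using (argmax; argmax-all; f[xs]≤f[argmax])

false≢true : false ≢ true
false≢true ()

module _ {A : Set} {f g : A → ℕ} where

  sum-map-mono-≤ : (∀ x → f x ≤ g x) → ∀ xs → sum (map f xs) ≤ sum (map g xs)
  sum-map-mono-≤ f≤g []       = z≤n
  sum-map-mono-≤ f≤g (x ∷ xs) = ℕ.+-mono-≤ (f≤g x) (sum-map-mono-≤ f≤g xs)

  sum-map-mono-< : (∀ x → f x ≤ g x) → ∀ {b xs} → b ∈ xs → f b < g b →
                   sum (map f xs) < sum (map g xs)
  sum-map-mono-< f≤g {xs = _ ∷ xs} (here refl) fb<gb =
    ℕ.+-mono-<-≤ fb<gb (sum-map-mono-≤ f≤g xs)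
  sum-map-mono-< f≤g {xs = x ∷ _} (there b∈xs) fb<gb =
    ℕ.+-mono-≤-< (f≤g x) (sum-map-mono-< f≤g b∈xs fb<gb)

  sum-map-suc : ∀ {b xs} → Unique xs → b ∈ xs → (∀ x → x ≢ b → f x ≡ g x) →
                g b ≡ suc (f b) → sum (map g xs) ≡ suc (sum (map f xs))
  sum-map-suc {xs = _ ∷ xs} (x∉xs ∷ _) (here refl) f≡g gb≡1+fb =
    cong₂ _+_ gb≡1+fb (sym (cong sum (map-cong-local (All.map (λ {y} x≢y → f≡g y (x≢y ∘ sym)) x∉xs))))
  sum-map-suc {b} {x ∷ xs} (x∉xs ∷ unique) (there b∈xs) f≡g gb≡1+fb = begin
    g x + sum (map g xs)        ≡⟨ cong₂ _+_ (sym (f≡g x x≢b)) (sum-map-suc unique b∈xs f≡g gb≡1+fb) ⟩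
    f x + suc (sum (map f xs))  ≡⟨ ℕ.+-suc (f x) _ ⟩
    suc (f x + sum (map f xs))  ∎
    where
    open ≡-Reasoning
    x≢b : x ≢ b
    x≢b x≡b = All.lookup x∉xs b∈xs x≡b

+/suc-≤ : ∀ a b c d → a * suc d ≤ c * suc b → + a / suc b ≤ℚ + c / suc d
+/suc-≤ a b c d ad≤cb =
  ℚ.toℚᵘ-cancel-≤
    (ℚᵘ.≤-respˡ-≃ (ℚᵘ.≃-sym (ℚ.toℚᵘ-fromℚᵘ (mkℚᵘ (+ a) b)))
      (ℚᵘ.≤-respʳ-≃ (ℚᵘ.≃-sym (ℚ.toℚᵘ-fromℚᵘ (mkℚᵘ (+ c) d)))
        (*≤* (subst₂ _≤ℤ_ (ℤ.pos-* a (suc d)) (ℤ.pos-* c (suc b)) (+≤+ ad≤cb)))))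

+/suc-monoˡ-≤ : ∀ {a c} d → a ≤ c → + a / suc d ≤ℚ + c / suc d
+/suc-monoˡ-≤ {a} {c} d a≤c = +/suc-≤ a d c d (ℕ.*-monoˡ-≤ (suc d) a≤c)

n/1+n≤1+m/1+m : ∀ n m → + n / suc n ≤ℚ + suc m / suc m
n/1+n≤1+m/1+m n m = +/suc-≤ n n (suc m) m
  (subst (n * suc m ≤_) (ℕ.*-comm (suc n) (suc m)) (ℕ.*-monoˡ-≤ (suc m) (ℕ.n≤1+n n)))

module _ {n : ℕ} (q : Fin n → ℚ) {u v : Fin n} {p p′ : ℚ} (qu≡p : q u ≡ p) (qv≡p′ : q v ≡ p′) where

  ⊓-attained : ∃ λ w → q w ≡ p ⊓ p′
  ⊓-attained with ℚ.⊓-sel p p′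
  ... | inj₁ p⊓p′≡p  = u , trans qu≡p (sym p⊓p′≡p)
  ... | inj₂ p⊓p′≡p′ = v , trans qv≡p′ (sym p⊓p′≡p′)

  ⊓-lowerBound : (∀ w → w ≢ u → w ≢ v → p ⊓ p′ ≤ℚ q w) → ∀ w → p ⊓ p′ ≤ℚ q w
  ⊓-lowerBound others w with w ≟ u | w ≟ v
  ... | yes refl | _        = subst (p ⊓ p′ ≤ℚ_) (sym qu≡p) (ℚ.p⊓q≤p p p′)
  ... | no _     | yes refl = subst (p ⊓ p′ ≤ℚ_) (sym qv≡p′) (ℚ.p⊓q≤q p p′)
  ... | no w≢u   | no w≢v   = others w w≢u w≢v

lookup-injective : ∀ {A : Set} {xs : List A} → Unique xs → ∀ {i j} → lookup xs i ≡ lookup xs j → i ≡ j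
lookup-injective {xs = _ ∷ _} _            {zero}  {zero}  _  = refl
lookup-injective {xs = _ ∷ _} (x∉xs ∷ _)   {zero}  {suc j} eq = ⊥-elim (All.lookup x∉xs (∈-lookup j) eq)
lookup-injective {xs = _ ∷ _} (x∉xs ∷ _)   {suc i} {zero}  eq = ⊥-elim (All.lookup x∉xs (∈-lookup i) (sym eq))
lookup-injective {xs = _ ∷ _} (_ ∷ unique) {suc i} {suc j} eq = cong suc (lookup-injective unique eq)

Unique⇒length≤ : ∀ {n} {xs : List (Fin n)} → Unique xs → length xs ≤ n
Unique⇒length≤ unique = injective⇒≤ (lookup-injective unique)

-- xs lists the vertices after a; b is its last element unless xs = [].
data Chain {n : ℕ} (R : Fin n → Fin n → Set) : Fin n → Fin n → List (Fin n) → Set where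
  stop : ∀ {a} → Chain R a a []
  step : ∀ {a x b xs} → R a x → Chain R x b xs → Chain R a b (x ∷ xs)

module _ {n : ℕ} {R : Fin n → Fin n → Set} where
  open DecMembership {A = Fin n} _≟_ using (_∈?_)

  private
    suffix : ∀ {x b ys c} → Chain R x b ys → Unique (x ∷ ys) → c ∈ x ∷ ys →
             ∃ λ zs → Chain R c b zs × Unique (c ∷ zs)
    suffix chain          unique       (here refl)  = _ , chain , unique
    suffix (step _ chain) (_ ∷ unique) (there c∈ys) = suffix chain unique c∈ys

  simplify : ∀ {a b ys} → Chain R a b ys → ∃ λ zs → Chain R a b zs × Unique (a ∷ zs)
  simplify stop = [] , stop , [] ∷ []
  simplify {a} (step {x = x} r chain) with simplify chain
  ... | zs , chain′ , unique with a ∈? x ∷ zs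
  ...   | yes a∈ = suffix chain′ unique a∈
  ...   | no a∉  = x ∷ zs , step r chain′ , ¬Any⇒All¬ _ a∉ ∷ unique

  Chain⇒Linked : ∀ {S : Fin n → Fin n → Set} → (∀ {a b} → R a b → S a b) →
                 ∀ {a b c zs} → Chain R a b zs → S b c → Linked S (a ∷ zs ++ [ c ])
  Chain⇒Linked R⇒S stop           s = s ∷ [-]
  Chain⇒Linked R⇒S (step r chain) s = R⇒S r ∷ Chain⇒Linked R⇒S chain s

module Reachability {n : ℕ} {R : Fin n → Fin n → Set} (R? : ∀ a b → Dec (R a b)) (t : Fin n) where

  WithinSteps : ℕ → Fin n → Set
  WithinSteps zero    w = w ≡ t
  WithinSteps (suc k) w = w ≡ t ⊎ ∃ λ x → R w x × WithinSteps k x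

  withinSteps? : ∀ k w → Dec (WithinSteps k w)
  withinSteps? zero    w = w ≟ t
  withinSteps? (suc k) w = (w ≟ t) ⊎-dec any? (λ x → R? w x ×-dec withinSteps? k x)

  WithinSteps⇒Chain : ∀ k {w} → WithinSteps k w → ∃ λ zs → Chain R w t zs
  WithinSteps⇒Chain zero    refl                   = [] , stop
  WithinSteps⇒Chain (suc k) (inj₁ refl)            = [] , stop
  WithinSteps⇒Chain (suc k) (inj₂ (x , r , within)) =
    let zs , chain = WithinSteps⇒Chain k within in x ∷ zs , step r chain

  Chain⇒WithinSteps : ∀ k {w zs} → Chain R w t zs → length zs ≤ k → WithinSteps k w
  Chain⇒WithinSteps zero    stop           _         = refl
  Chain⇒WithinSteps (suc k) stop           _         = inj₁ refl
  Chain⇒WithinSteps (suc k) (step r chain) (s≤s len) = inj₂ (_ , r , Chain⇒WithinSteps k chain len)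

  -- n steps suffice: a simple chain visits at most n vertices.
  reaches : Fin n → Bool
  reaches w = does (withinSteps? n w)

  Chain⇒reaches : ∀ {w zs} → Chain R w t zs → reaches w ≡ true
  Chain⇒reaches {w} chain =
    let zs , chain′ , unique = simplify chain
    in dec-true (withinSteps? n w)
         (Chain⇒WithinSteps n chain′ (ℕ.≤-trans (ℕ.n≤1+n (length zs)) (Unique⇒length≤ unique)))

  reaches⇒Chain : ∀ {w} → reaches w ≡ true → ∃ λ zs → Chain R w t zs
  reaches⇒Chain {w} _ with withinSteps? n w
  reaches⇒Chain     _  | yes within = WithinSteps⇒Chain n within
  reaches⇒Chain     () | no _

  reaches-resp : (∀ {a b} → R a b → R b a) → ∀ {a b} → R a b → reaches b ≡ reaches a
  reaches-resp R-sym {a} {b} r = ⇔→≡ (mk⇔ (extend r) (extend (R-sym r)))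
    where
    extend : ∀ {x y} → R x y → reaches y ≡ true → reaches x ≡ true
    extend r reached = Chain⇒reaches (step r (proj₂ (reaches⇒Chain reached)))

module _ {n : ℕ} (G : Graph n) where
  open Graph G using (adj)

  Adj-sym : ∀ {a b} → Adj G a b → Adj G b a
  Adj-sym {a} {b} ab = trans (Graph.sym G b a) ab

  Adj⇒≢ : ∀ {a b} → Adj G a b → a ≢ b
  Adj⇒≢ {a} aa refl with () ← trans (sym (Graph.irrefl G a)) aa

  crossingEdge : ∀ (side : Fin n → Bool) {a b} → Walk G a b → side a ≡ true → side b ≡ false →
                 ∃₂ λ x y → Adj G x y × side x ≡ true × side y ≡ false
  crossingEdge side stop sa sb with () ← trans (sym sa) sb
  crossingEdge side {a} (step {v = c} ac walk) sa sb with side c in sc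
  ... | true  = crossingEdge side walk sc sb
  ... | false = a , c , ac , sa , sc

  -- a ≢ b and ¬ R a b force the chain to take at least two steps.
  closedChain⇒HasCycle : ∀ {R : Fin n → Fin n → Set} → (∀ {x y} → R x y → Adj G x y) →
                         ∀ {a b zs} → Chain R a b zs → Unique (a ∷ zs) → Adj G b a → a ≢ b → ¬ R a b →
                         HasCycle G
  closedChain⇒HasCycle R⇒Adj stop                      _      _  a≢b _   = ⊥-elim (a≢b refl)
  closedChain⇒HasCycle R⇒Adj (step r stop)             _      _  _   ¬ab = ⊥-elim (¬ab r)
  closedChain⇒HasCycle R⇒Adj chain@(step _ (step _ _)) unique ba _   _   =
    _ , _ , unique , s≤s (s≤s z≤n) , Chain⇒Linked R⇒Adj chain ba

  private
    neighbour : Fin n → Fin n → ℕ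
    neighbour w x = if adj w x then 1 else 0

    sameSideNeighbour : (Fin n → Bool) → Fin n → Fin n → ℕ
    sameSideNeighbour side w x = if adj w x then sameSide G (side x) (side w) else 0

    sameSide≤1 : ∀ b c → sameSide G b c ≤ 1
    sameSide≤1 true  true  = ℕ.≤-refl
    sameSide≤1 true  false = z≤n
    sameSide≤1 false true  = z≤n
    sameSide≤1 false false = ℕ.≤-refl

    sameSide-refl : ∀ b → sameSide G b b ≡ 1
    sameSide-refl true  = refl
    sameSide-refl false = refl

    sameSide-≢ : ∀ {b c} → b ≢ c → sameSide G b c ≡ 0
    sameSide-≢ {true}  {true}  b≢c = ⊥-elim (b≢c refl)
    sameSide-≢ {true}  {false} _   = refl
    sameSide-≢ {false} {true}  _   = refl
    sameSide-≢ {false} {false} b≢c = ⊥-elim (b≢c refl)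

    sameSideNeighbour≤neighbour : ∀ side w x → sameSideNeighbour side w x ≤ neighbour w x
    sameSideNeighbour≤neighbour side w x with adj w x
    ... | false = z≤n
    ... | true  = sameSide≤1 (side x) (side w)

    sameSideNeighbour≡neighbour : ∀ side w x → (Adj G w x → side x ≡ side w) →
                                  sameSideNeighbour side w x ≡ neighbour w x
    sameSideNeighbour≡neighbour side w x same with adj w x
    ... | false = refl
    ... | true  = trans (cong (λ b → sameSide G b (side w)) (same refl)) (sameSide-refl (side w))

    crossing-neighbour : ∀ side {w x} → Adj G w x → side x ≢ side w →
                         neighbour w x ≡ suc (sameSideNeighbour side w x)
    crossing-neighbour side {w} {x} wx crossing rewrite wx = cong suc (sym (sameSide-≢ crossing))

  closedSame≤degree : ∀ side {w x} → Adj G w x → side x ≢ side w → closedSame G side w ≤ degree G w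
  closedSame≤degree side {w} {x} wx crossing =
    sum-map-mono-< (sameSideNeighbour≤neighbour side w) (∈-allFin x)
      (ℕ.≤-reflexive (sym (crossing-neighbour side wx crossing)))

  closedSame≡1+degree : ∀ side {w} → (∀ x → Adj G w x → side x ≡ side w) →
                        closedSame G side w ≡ suc (degree G w)
  closedSame≡1+degree side {w} same =
    cong suc (cong sum (map-cong (λ x → sameSideNeighbour≡neighbour side w x (same x)) (allFin n)))

  closedSame≡degree : ∀ side {w b} → Adj G w b → side b ≢ side w →
                      (∀ x → x ≢ b → Adj G w x → side x ≡ side w) → closedSame G side w ≡ degree G w
  closedSame≡degree side {w} {b} wb crossing same =
    sym (sum-map-suc (allFin⁺ n) (∈-allFin b)
          (λ x x≢b → sameSideNeighbour≡neighbour side w x (same x x≢b))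
          (crossing-neighbour side wb crossing))

  qv≤degRatio : ∀ side {w x} → Adj G w x → side x ≢ side w → qv G side w ≤ℚ degRatio G w
  qv≤degRatio side {w} wx crossing = +/suc-monoˡ-≤ (degree G w) (closedSame≤degree side wx crossing)

  degRatio≤qv : ∀ side {w} → (∀ x → Adj G w x → side x ≡ side w) → ∀ u → degRatio G u ≤ℚ qv G side w
  degRatio≤qv side {w} same u =
    subst (λ c → degRatio G u ≤ℚ + c / suc (degree G w)) (sym (closedSame≡1+degree side same))
      (n/1+n≤1+m/1+m (degree G u) (degree G w))

  IsMinQ⇒≤edge : ∀ {side s} → Connected G → IsPartition G side → IsMinQ G side s →
                 ∃₂ λ x y → Adj G x y × s ≤ℚ degRatio G x ⊓ degRatio G y
  IsMinQ⇒≤edge {side} connected ((a , sa) , (b , sb)) (_ , s≤qv) =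
    let x , y , xy , sx , sy = crossingEdge side (connected a b) sa sb
        y≢x = λ e → false≢true (trans (sym sy) (trans e sx))
    in x , y , xy ,
       ℚ.⊓-glb (ℚ.≤-trans (s≤qv x) (qv≤degRatio side xy y≢x))
               (ℚ.≤-trans (s≤qv y) (qv≤degRatio side (Adj-sym xy) (y≢x ∘ sym)))

  IsEdge : Fin n × Fin n → Set
  IsEdge = uncurry (Adj G)

  edgeRatio : Fin n × Fin n → ℚ
  edgeRatio e = degRatio G (proj₁ e) ⊓ degRatio G (proj₂ e)

  maximalEdge : ∀ {u₀ v₀} → Adj G u₀ v₀ →
                ∃₂ λ u v → Adj G u v × ∀ x y → Adj G x y → edgeRatio (x , y) ≤ℚ edgeRatio (u , v)
  maximalEdge {u₀} {v₀} u₀v₀ =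
    proj₁ best , proj₂ best , argmax-all edgeRatio {P = IsEdge} u₀v₀ (all-filter isEdge? pairs) ,
    λ x y xy → All.lookup (f[xs]≤f[argmax] {f = edgeRatio} (u₀ , v₀) edges)
                 (∈-filter⁺ isEdge? (∈-cartesianProduct⁺ (∈-allFin x) (∈-allFin y)) xy)
    where
    isEdge? : ∀ e → Dec (IsEdge e)
    isEdge? (x , y) = adj x y ≟ᵇ true
    pairs edges : List (Fin n × Fin n)
    pairs = cartesianProduct (allFin n) (allFin n)
    edges = filter isEdge? pairs
    best : Fin n × Fin n
    best = argmax edgeRatio (u₀ , v₀) edges

  module EdgeRemoval {u v : Fin n} (uv : Adj G u v) where

    _∼_ : Fin n → Fin n → Set
    a ∼ b = Adj G a b × ¬ (a ≡ u × b ≡ v) × ¬ (a ≡ v × b ≡ u)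

    _∼?_ : ∀ a b → Dec (a ∼ b)
    a ∼? b = (adj a b ≟ᵇ true) ×-dec ¬? ((a ≟ u) ×-dec (b ≟ v)) ×-dec ¬? ((a ≟ v) ×-dec (b ≟ u))

    ∼-sym : ∀ {a b} → a ∼ b → b ∼ a
    ∼-sym (ab , ¬uv , ¬vu) = Adj-sym ab , (λ (p , q) → ¬vu (q , p)) , (λ (p , q) → ¬uv (q , p))

    open Reachability _∼?_ u

    side : Fin n → Bool
    side = reaches

    side-∼ : ∀ {a b} → a ∼ b → side b ≡ side a
    side-∼ = reaches-resp ∼-sym

    side-u : side u ≡ true
    side-u = Chain⇒reaches stop

    side-v : ¬ HasCycle G → side v ≡ false
    side-v acyclic with side v in sv
    ... | false = refl
    ... | true  =
      let _ , chain , unique = simplify (proj₂ (reaches⇒Chain sv))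
      in ⊥-elim (acyclic (closedChain⇒HasCycle proj₁ chain unique uv (Adj⇒≢ (Adj-sym uv))
                                                (λ (_ , _ , ¬vu) → ¬vu (refl , refl))))

    partition : ¬ HasCycle G → IsPartition G side
    partition acyclic = (u , side-u) , (v , side-v acyclic)

    side-v≢side-u : ¬ HasCycle G → side v ≢ side u
    side-v≢side-u acyclic e = false≢true (trans (sym (side-v acyclic)) (trans e side-u))

    qv-u : ¬ HasCycle G → qv G side u ≡ degRatio G u
    qv-u acyclic = cong (λ c → + c / suc (degree G u))
      (closedSame≡degree side uv (side-v≢side-u acyclic)
        (λ x x≢v ux → side-∼ (ux , (λ (_ , q) → x≢v q) , (λ (p , _) → Adj⇒≢ uv p))))

    qv-v : ¬ HasCycle G → qv G side v ≡ degRatio G v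
    qv-v acyclic = cong (λ c → + c / suc (degree G v))
      (closedSame≡degree side (Adj-sym uv) (side-v≢side-u acyclic ∘ sym)
        (λ x x≢u vx → side-∼ (vx , (λ (p , _) → Adj⇒≢ uv (sym p)) , (λ (_ , q) → x≢u q))))

    minQ : ¬ HasCycle G → IsMinQ G side (degRatio G u ⊓ degRatio G v)
    minQ acyclic =
      ⊓-attained (qv G side) (qv-u acyclic) (qv-v acyclic) ,
      ⊓-lowerBound (qv G side) (qv-u acyclic) (qv-v acyclic) λ w w≢u w≢v →
        ℚ.≤-trans (ℚ.p⊓q≤p (degRatio G u) (degRatio G v))
          (degRatio≤qv side (λ x wx → side-∼ (wx , w≢u ∘ proj₁ , w≢v ∘ proj₁)) u)

  maximalEdge⇒IsQ : Connected G → ¬ HasCycle G → ∀ {u v} (uv : Adj G u v) →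
                    (∀ x y → Adj G x y → edgeRatio (x , y) ≤ℚ edgeRatio (u , v)) →
                    IsQ G (edgeRatio (u , v))
  maximalEdge⇒IsQ connected acyclic uv maximal =
    (side , partition acyclic , minQ acyclic) , atMostEdgeMax
    where
    open EdgeRemoval uv
    atMostEdgeMax : ∀ side′ s → IsPartition G side′ → IsMinQ G side′ s → s ≤ℚ edgeRatio _
    atMostEdgeMax _ _ partition′ minQ′ =
      let x , y , xy , s≤xy = IsMinQ⇒≤edge connected partition′ minQ′
      in ℚ.≤-trans s≤xy (maximal x y xy)

connected⇒edge : ∀ {n} (G : Graph n) → 2 ≤ n → Connected G → ∃₂ λ x y → Adj G x y
connected⇒edge G (s≤s (s≤s _)) connected =
  let x , y , xy , _ = crossingEdge G (λ x → does (x ≟ zero)) (connected zero (suc zero)) refl refl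
  in x , y , xy

corollary1 : (n : ℕ) (G : Graph n) → 2 ≤ n → IsTree G →
    ∃ λ (r : ℚ) → IsQ G r × IsEdgeMax G r
corollary1 n G 2≤n (connected , acyclic) =
  let _ , _ , u₀v₀ = connected⇒edge G 2≤n connected
      u , v , uv , maximal = maximalEdge G u₀v₀
  in edgeRatio G (u , v) , maximalEdge⇒IsQ G connected acyclic uv maximal , (u , v , uv , refl) , maximal
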